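{- Let $\mathcal{F}$ be a set of oriented trees which is a complete set of obstructions for a digraph $H$. Then the set $\mathrm{Sproink}(\mathcal{F})=\bigcup_{T\in\mathcal{F}}\mathrm{Sproink}(T)$ is a complete set of obstructions for the arc graph $\delta H$.
   Context: Digraphs and homomorphisms as usual; $G\to H$ means there is a homomorphism from $G$ to $H$. A set $\mathcal{F}$ of digraphs is a complete set of obstructions for $H$ if for every digraph $G$: $G\to H$ iff no $F\in\mathcal{F}$ satisfies $F\to G$. An oriented tree is a digraph whose underlying undirected graph is a tree. The arc graph of $H=(V,A)$ is $\delta H=(A,\delta A)$ with $\delta A=\{((u,v),(v,w)) : (u,v),(v,w)\in A\}$. A tree $F$ has height at most one if its vertex set can be partitioned into $0_F,1_F$ such that every arc $(x,y)$ has $x\in 0_F$, $y\in 1_F$. For an oriented tree $T$: for every vertex $u$ of $T$ choose a tree $F(u)$ of height at most one, and for every arc $e$ of $T$ incident with $u$ choose a vertex $v(e,F(u))$ of $F(u)$ with $v(e,F(u))\in 1_{F(u)}$ if $u$ is the initial vertex of $e$ and $v(e,F(u))\in 0_{F(u)}$ if $u$ is the terminal vertex of $e$; the tree obtained from the disjoint union of the $F(u)$ by identifying $v(e,F(u))$ with $v(e,F(u'))$ for every arc $e=(u,u')$ of $T$ is a sproink of $T$. $\mathrm{Sproink}(T)$ is the set of all sproinks of $T$. -}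

module Defs where

open import Data.Nat using (ℕ; _≤_)
open import Data.Fin using (Fin)
open import Data.Fin.Properties using (_≟_)
open import Data.Bool using (Bool; true; false; T)
open import Data.Empty using (⊥)
open import Data.Sum using (_⊎_)
open import Data.List using (List; []; _∷_; _∷ʳ_; length; lookup; allFin; cartesianProduct; filterᵇ)
open import Data.List.Relation.Unary.Linked using (Linked)
open import Data.List.Relation.Unary.Unique.Propositional using (Unique)
open import Data.Product using (Σ; ∃; _×_; _,_; proj₁; proj₂)
open import Relation.Nullary using (¬_)
open import Relation.Nullary.Decidable using (⌊_⌋)
open import Relation.Binary.PropositionalEquality using (_≡_)
open import Relation.Binary.Construct.Closure.ReflexiveTransitive using (Star)
open import Relation.Binary.Construct.Closure.Equivalence using (EqClosure)
open import Function.Bundles using (_⇔_)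

record Digraph : Set where
  field
    size : ℕ
    arc  : Fin (size) → Fin (size) → Bool
open Digraph public

_⟶_ : Digraph → Digraph → Set
G ⟶ H = Σ (Fin (size G) → Fin (size H))
          (λ f → ∀ x y → T (arc G x y) → T (arc H (f x) (f y)))

CompleteObstructions : (Digraph → Set) → Digraph → Set
CompleteObstructions 𝓕 H =
  ∀ G → (G ⟶ H) ⇔ (¬ Σ Digraph (λ F → 𝓕 F × (F ⟶ G)))

-- Arc graph δH: vertices are the arcs of H (enumerated without repetition),
-- with an arc from (u,v) to (v',w) iff v = v'.
arcList : (H : Digraph) → List (Fin (size H) × Fin (size H))
arcList H = filterᵇ (λ p → arc H (proj₁ p) (proj₂ p))
                    (cartesianProduct (allFin (size H)) (allFin (size H)))

δ : Digraph → Digraph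
δ H = record
  { size = length (arcList H)
  ; arc  = λ i j → ⌊ proj₂ (lookup (arcList H) i) ≟ proj₁ (lookup (arcList H) j) ⌋
  }

Adj : (G : Digraph) → Fin (size G) → Fin (size G) → Set
Adj G x y = T (arc G x y) ⊎ T (arc G y x)

IsCycle : (G : Digraph) → List (Fin (size G)) → Set
IsCycle G [] = ⊥
IsCycle G (v ∷ vs) =
  (3 ≤ length (v ∷ vs)) × Unique (v ∷ vs) × Linked (Adj G) ((v ∷ vs) ∷ʳ v)

record IsOrientedTree (G : Digraph) : Set where
  field
    nonempty  : 1 ≤ size G
    loopless  : ∀ x → ¬ T (arc G x x)
    no-digon  : ∀ x y → T (arc G x y) → ¬ T (arc G y x)
    connected : ∀ x y → Star (Adj G) x y
    acyclic   : ∀ (cs : List (Fin (size G))) → ¬ IsCycle G cs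

-- Height at most one w.r.t. a partition (false = 0_F, true = 1_F).
HeightAtMostOne : (F : Digraph) → (Fin (size F) → Bool) → Set
HeightAtMostOne F side = ∀ x y → T (arc F x y) → (side x ≡ false) × (side y ≡ true)

record SproinkData (Tr : Digraph) : Set where
  field
    F        : Fin (size Tr) → Digraph
    F-tree   : ∀ u → IsOrientedTree (F u)
    side     : ∀ u → Fin (size (F u)) → Bool
    F-height : ∀ u → HeightAtMostOne (F u) (side u)
    vOut     : ∀ u u' → T (arc Tr u u') → Fin (size (F u))
    vOut-1   : ∀ u u' (e : T (arc Tr u u')) → side u (vOut u u' e) ≡ true
    vIn      : ∀ u u' → T (arc Tr u u') → Fin (size (F u'))
    vIn-0    : ∀ u u' (e : T (arc Tr u u')) → side u' (vIn u u' e) ≡ false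

module SproinkOf {Tr : Digraph} (d : SproinkData Tr) where
  open SproinkData d

  Pt : Set
  Pt = Σ (Fin (size Tr)) (λ u → Fin (size (F u)))

  data Glue : Pt → Pt → Set where
    glue : ∀ u u' (e : T (arc Tr u u')) → Glue (u , vOut u u' e) (u' , vIn u u' e)

  data UArc : Pt → Pt → Set where
    uarc : ∀ u x y → T (arc (F u) x y) → UArc (u , x) (u , y)

-- S is a sproink of Tr: S is (isomorphic to) the quotient of the disjoint union
-- of the F(u) by the equivalence generated by the identifications; i.e. there is
-- a surjection π whose kernel is exactly that equivalence and whose arcs are
-- exactly the images of the arcs of the disjoint union.
IsSproink : Digraph → Digraph → Set
IsSproink Tr S = Σ (SproinkData Tr) λ d → let open SproinkOf d in
  Σ (Pt → Fin (size S)) λ π →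
    (∀ a → ∃ λ p → π p ≡ a)
    × (∀ p q → (π p ≡ π q) ⇔ EqClosure Glue p q)
    × (∀ a b → T (arc S a b) ⇔ (∃ λ p → ∃ λ q → (π p ≡ a) × (π q ≡ b) × UArc p q))

Sproinks : (Digraph → Set) → Digraph → Set
Sproinks 𝓕 S = Σ Digraph (λ Tr → 𝓕 Tr × IsSproink Tr S)

-- δ has a left adjoint δᴸ: δᴸ G is the quotient of one arc per vertex x of G, from tail x to head x, by the
-- identifications head x ~ tail y for the arcs x → y of G, and G → δ H as soon as δᴸ G → H. So G → δ H unless
-- some T ∈ 𝓕 maps to δᴸ G, and such a homomorphism unfolds into a sproink of T mapping to G: the tails and
-- heads over a vertex u of T form one class, connected by identifications, and a walk through it, read as a
-- zigzag path of height one, serves as F(u). Conversely, a homomorphism from a sproink of T to δ H sends the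
-- arcs of each F(u) to pairs of consecutive arcs of H, which all meet at one vertex since F(u) is connected;
-- this folds the sproink onto a homomorphism T → H, which 𝓕 forbids.
module Submission where

open import Defs
open import Data.Bool using (Bool; true; false; T; T?; not)
import Data.Bool.Properties as Bool
open import Data.Bool.Properties using (T-irrelevant)
open import Data.Empty using (⊥; ⊥-elim)
open import Data.Fin using (Fin; zero; suc; toℕ; fromℕ<)
import Data.Fin.Properties as Fin
open import Data.Fin.Properties using (toℕ-injective)
open import Data.List
  using (List; []; _∷_; _∷ʳ_; length; lookup; map; concatMap; filter; deduplicate; allFin; cartesianProduct)
open import Data.List.Membership.Propositional using (_∈_; lose)
open import Data.List.Membership.Propositional.Properties
  using ( ∈-map⁺; ∈-map⁻; ∈-concatMap⁺; ∈-filter⁺; ∈-filter⁻; ∈-deduplicate⁺; ∈-deduplicate⁻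
        ; ∈-lookup; ∈-allFin; ∈-cartesianProduct⁺)
open import Data.List.Relation.Unary.All as All using (All; []; _∷_)
open import Data.List.Relation.Unary.Any using (here; there; index; satisfied; any?)
open import Data.List.Relation.Unary.Any.Properties using (lookup-index)
open import Data.List.Relation.Unary.Linked as Linked using (Linked; [-]; _∷_)
open import Data.List.Relation.Unary.Unique.Propositional using (Unique; _∷_)
open import Data.List.Relation.Unary.Unique.DecPropositional.Properties using (deduplicate-!)
open import Data.Nat using (ℕ; suc; _<_; _≤_; s≤s; z≤n)
import Data.Nat.Properties as ℕ
open import Data.Nat.Properties using (1+n≢n; suc-injective; n<1+n; <-trans; <-asym; m≤n⇒m<n∨m≡n)
open import Data.Product using (Σ; ∃; ∃₂; _×_; _,_; proj₁; proj₂; uncurry)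
open import Data.Product.Properties using (≡-dec)
import Data.Sum as Sum
open import Data.Sum using (_⊎_; inj₁; inj₂; [_,_]′; swap)
open import Function using (_∘_)
open import Function.Bundles using (_⇔_; mk⇔; Equivalence)
open import Level using (0ℓ)
open import Relation.Binary using (Rel; Decidable; DecidableEquality; Symmetric)
open import Relation.Binary.Construct.Closure.ReflexiveTransitive as Star using (Star; ε; _◅_; _◅◅_)
open import Relation.Binary.Construct.Closure.Symmetric as SymClosure using (SymClosure; fwd; bwd)
open import Relation.Binary.Construct.Closure.Equivalence as EqClosure using (EqClosure)
import Relation.Binary.Construct.On as On
open import Relation.Binary.PropositionalEquality
  using (_≡_; refl; sym; trans; cong; subst; subst₂; isEquivalence; module ≡-Reasoning)
open import Relation.Nullary using (¬_; Dec; yes; no)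
open import Relation.Nullary.Decidable using (⌊_⌋; map′; toWitness; fromWitness; _×-dec_; _⊎-dec_)

-- Finite quotients

Enumeration : Set → Set
Enumeration A = Σ (List A) λ xs → ∀ x → x ∈ xs

Fin-enumeration : ∀ n → Enumeration (Fin n)
Fin-enumeration n = allFin n , ∈-allFin

Bool-enumeration : Enumeration Bool
Bool-enumeration = true ∷ false ∷ [] , λ { true → here refl ; false → there (here refl) }

Σ-enumeration : {A : Set} {B : A → Set} →
                Enumeration A → (∀ a → Enumeration (B a)) → Enumeration (Σ A B)
Σ-enumeration (as , ∈as) bs =
  concatMap (λ a → map (a ,_) (proj₁ (bs a))) as ,
  λ (a , b) → ∈-concatMap⁺ _ (lose (∈as a) (∈-map⁺ (a ,_) (proj₂ (bs a) b)))

∃? : {A : Set} {P : A → Set} → Enumeration A → (∀ x → Dec (P x)) → Dec (∃ P)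
∃? (xs , ∈xs) P? = map′ satisfied (λ (x , px) → lose (∈xs x) px) (any? P? xs)

Unique⇒lookup-injective : {A : Set} {xs : List A} → Unique xs →
                          ∀ i j → lookup xs i ≡ lookup xs j → i ≡ j
Unique⇒lookup-injective (_ ∷ _)    zero    zero    _  = refl
Unique⇒lookup-injective (x∉ ∷ _)   zero    (suc j) eq = ⊥-elim (All.lookup x∉ (∈-lookup j) eq)
Unique⇒lookup-injective (x∉ ∷ _)   (suc i) zero    eq = ⊥-elim (All.lookup x∉ (∈-lookup i) (sym eq))
Unique⇒lookup-injective (_ ∷ uniq) (suc i) (suc j) eq = cong suc (Unique⇒lookup-injective uniq i j eq)

record FiniteQuotient (A : Set) (_∼_ : Rel A 0ℓ) : Set where
  field
    card             : ℕ
    class            : A → Fin card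
    class-surjective : ∀ i → ∃ λ p → class p ≡ i
    class-≡⇔         : ∀ p q → (class p ≡ class q) ⇔ p ∼ q

module _ {A B : Set} (_≟_ : DecidableEquality B) where

  -- classes are numbered by the position of their value in the duplicate-free list of values
  kernelQuotient : Enumeration A → (r : A → B) → FiniteQuotient A (λ p q → r p ≡ r q)
  kernelQuotient (as , ∈as) r = record
    { card             = length values
    ; class            = class
    ; class-surjective = surjective
    ; class-≡⇔         = λ p q → mk⇔ (to p q) (from p q)
    }
    where
    values : List B
    values = deduplicate _≟_ (map r as)

    value∈ : ∀ p → r p ∈ values
    value∈ p = ∈-deduplicate⁺ _≟_ (∈-map⁺ r (∈as p))

    class : A → Fin (length values)
    class p = index (value∈ p)

    lookup-class : ∀ p → lookup values (class p) ≡ r p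
    lookup-class p = sym (lookup-index (value∈ p))

    injective : ∀ i j → lookup values i ≡ lookup values j → i ≡ j
    injective = Unique⇒lookup-injective (deduplicate-! _≟_ (map r as))

    to : ∀ p q → class p ≡ class q → r p ≡ r q
    to p q eq = trans (sym (lookup-class p)) (trans (cong (lookup values) eq) (lookup-class q))

    from : ∀ p q → r p ≡ r q → class p ≡ class q
    from p q eq = injective _ _ (trans (lookup-class p) (trans eq (sym (lookup-class q))))

    surjective : ∀ i → ∃ λ p → class p ≡ i
    surjective i with ∈-map⁻ r (∈-deduplicate⁻ _≟_ (map r as) (∈-lookup {xs = values} i))
    ... | p , _ , eq = p , injective _ _ (trans (lookup-class p) (sym eq))

module UnionFind {A : Set} (_≟_ : DecidableEquality A) where

  Listed : List (A × A) → Rel A 0ℓ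
  Listed L p q = (p , q) ∈ L

  -- union–find without path compression: processing (a , b) merges the class of a into that of b
  representative : List (A × A) → A → A
  representative []            p = p
  representative ((a , b) ∷ L) p with representative L p ≟ representative L a
  ... | yes _ = representative L b
  ... | no  _ = representative L p

  representative-merge : ∀ a b L → representative ((a , b) ∷ L) a ≡ representative ((a , b) ∷ L) b
  representative-merge a b L
    with representative L a ≟ representative L a | representative L b ≟ representative L a
  ... | yes _   | yes _ = refl
  ... | yes _   | no  _ = refl
  ... | no a≢a  | _     = ⊥-elim (a≢a refl)

  representative-mono : ∀ a b L p q → representative L p ≡ representative L q →
                        representative ((a , b) ∷ L) p ≡ representative ((a , b) ∷ L) q
  representative-mono a b L p q eq
    with representative L p ≟ representative L a | representative L q ≟ representative L a
  ... | yes _   | yes _   = refl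
  ... | yes p≈a | no q≉a  = ⊥-elim (q≉a (trans (sym eq) p≈a))
  ... | no p≉a  | yes q≈a = ⊥-elim (p≉a (trans eq q≈a))
  ... | no _    | no _    = eq

  representative-listed : ∀ L {p q} → Listed L p q → representative L p ≡ representative L q
  representative-listed ((a , b) ∷ L) (here refl) = representative-merge a b L
  representative-listed ((a , b) ∷ L) (there pq)  =
    representative-mono a b L _ _ (representative-listed L pq)

  representative-sound : ∀ L {p q} → EqClosure (Listed L) p q → representative L p ≡ representative L q
  representative-sound L =
    EqClosure.fold (On.isEquivalence (representative L) isEquivalence) (representative-listed L)

  private
    weaken : ∀ {e L p q} → EqClosure (Listed L) p q → EqClosure (Listed (e ∷ L)) p q
    weaken = EqClosure.map there

  representative-complete : ∀ L p q → representative L p ≡ representative L q → EqClosure (Listed L) p q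
  representative-complete []            p q refl = ε
  representative-complete ((a , b) ∷ L) p q eq
    with representative L p ≟ representative L a | representative L q ≟ representative L a
  ... | yes p≈a | yes q≈a = weaken (representative-complete L p a p≈a)
                           ◅◅ EqClosure.symmetric _ (weaken (representative-complete L q a q≈a))
  ... | yes p≈a | no _    = weaken (representative-complete L p a p≈a)
                           ◅◅ fwd (here refl) ◅ weaken (representative-complete L b q eq)
  ... | no _    | yes q≈a = weaken (representative-complete L p b eq)
                           ◅◅ bwd (here refl) ◅ EqClosure.symmetric _ (weaken (representative-complete L q a q≈a))
  ... | no _    | no _    = weaken (representative-complete L p q eq)

closureQuotient : {A : Set} {R : Rel A 0ℓ} → DecidableEquality A → Enumeration A → Decidable R →
                  FiniteQuotient A (EqClosure R)
closureQuotient {A} {R} _≟_ enum R? = record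
  { FiniteQuotient kernel
  ; class-≡⇔ = λ p q → mk⇔
      (λ eq → EqClosure.map listed⇒R (representative-complete generators p q (Equivalence.to (class-≡⇔ p q) eq)))
      (λ p~q → Equivalence.from (class-≡⇔ p q) (representative-sound generators (EqClosure.map R⇒listed p~q)))
  }
  where
  open UnionFind _≟_

  pairs : Enumeration (A × A)
  pairs = Σ-enumeration enum (λ _ → enum)

  R²? : ∀ (pq : A × A) → Dec (R (proj₁ pq) (proj₂ pq))
  R²? (p , q) = R? p q

  generators : List (A × A)
  generators = filter R²? (proj₁ pairs)

  R⇒listed : ∀ {p q} → R p q → Listed generators p q
  R⇒listed {p} {q} = ∈-filter⁺ R²? (proj₂ pairs (p , q))

  listed⇒R : ∀ {p q} → Listed generators p q → R p q
  listed⇒R = proj₂ ∘ ∈-filter⁻ R²? {xs = proj₁ pairs}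

  kernel : FiniteQuotient A (λ p q → representative generators p ≡ representative generators q)
  kernel = kernelQuotient _≟_ enum (representative generators)
  open FiniteQuotient kernel using (class-≡⇔)

module QuotientDigraph {A : Set} {_∼_ : Rel A 0ℓ} (Q : FiniteQuotient A _∼_) (enum : Enumeration A)
                       {Arc : Rel A 0ℓ} (Arc? : Decidable Arc) where
  open FiniteQuotient Q public

  ImageArc : Rel (Fin card) 0ℓ
  ImageArc i j = ∃₂ λ p q → class p ≡ i × class q ≡ j × Arc p q

  imageArc? : Decidable ImageArc
  imageArc? i j = ∃? enum λ p → ∃? enum λ q → (class p Fin.≟ i) ×-dec (class q Fin.≟ j) ×-dec Arc? p q

  digraph : Digraph
  digraph = record { size = card ; arc = λ i j → ⌊ imageArc? i j ⌋ }

  arc⇔ : ∀ i j → T (arc digraph i j) ⇔ ImageArc i j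
  arc⇔ i j = mk⇔ toWitness fromWitness

  lift : (G : Digraph) (φ : A → Fin (size G)) → (∀ {p q} → p ∼ q → φ p ≡ φ q) →
         (∀ {p q} → Arc p q → T (arc G (φ p) (φ q))) → digraph ⟶ G
  lift G φ φ-resp φ-arc = φ/∼ , φ/∼-hom
    where
    φ/∼ : Fin card → Fin (size G)
    φ/∼ i = φ (proj₁ (class-surjective i))

    φ/∼-class : ∀ p → φ p ≡ φ/∼ (class p)
    φ/∼-class p = φ-resp (Equivalence.to (class-≡⇔ p _) (sym (proj₂ (class-surjective (class p)))))

    φ/∼-hom : ∀ i j → T (arc digraph i j) → T (arc G (φ/∼ i) (φ/∼ j))
    φ/∼-hom i j ij with toWitness ij
    ... | p , q , refl , refl , pq = subst₂ (λ x y → T (arc G x y)) (φ/∼-class p) (φ/∼-class q) (φ-arc pq)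

-- Zigzag paths

module _ {n : ℕ} where

  Up : Rel (Fin n) 0ℓ
  Up i j = toℕ j ≡ suc (toℕ i)

  Step : Rel (Fin n) 0ℓ
  Step i j = Up i j ⊎ Up j i

  step? : Decidable Step
  step? i j = (toℕ j ℕ.≟ suc (toℕ i)) ⊎-dec (toℕ i ℕ.≟ suc (toℕ j))

  last : Fin n → List (Fin n) → Fin n
  last x []       = x
  last _ (y ∷ ys) = last y ys

  last∈ : ∀ x y ys → last x (y ∷ ys) ∈ y ∷ ys
  last∈ _ y []       = here refl
  last∈ _ y (z ∷ zs) = there (last∈ y z zs)

  -- discrete intermediate value theorem: a walk by unit steps starting above v reaches v from v + 1
  descend : ∀ v x xs → Linked Step (x ∷ xs ∷ʳ v) → toℕ v < toℕ x → v ∈ xs ⊎ Up v (last x xs)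
  descend v x [] (inj₁ x↗v ∷ _) v<x = ⊥-elim (<-asym v<x (subst (toℕ x <_) (sym x↗v) (n<1+n _)))
  descend v x [] (inj₂ v↗x ∷ _) v<x = inj₂ v↗x
  descend v x (y ∷ ys) (x~y ∷ walk) v<x with v Fin.≟ y
  ... | yes refl = inj₁ (here refl)
  ... | no v≢y = [ inj₁ ∘ there , inj₂ ]′ (descend v y ys walk (v<y x~y))
    where
    v<y : Step x y → toℕ v < toℕ y
    v<y (inj₁ x↗y) = subst (toℕ v <_) (sym x↗y) (<-trans v<x (n<1+n _))
    v<y (inj₂ y↗x) with m≤n⇒m<n∨m≡n (subst (toℕ v <_) y↗x v<x)
    ... | inj₁ (s≤s v<y) = v<y
    ... | inj₂ v≡y       = ⊥-elim (v≢y (toℕ-injective (suc-injective v≡y)))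

  ascend : ∀ v x xs → Linked Step (x ∷ xs ∷ʳ v) → toℕ x < toℕ v → v ∈ xs ⊎ Up (last x xs) v
  ascend v x [] (inj₁ x↗v ∷ _) _   = inj₂ x↗v
  ascend v x [] (inj₂ v↗x ∷ _) x<v = ⊥-elim (<-asym x<v (subst (toℕ v <_) (sym v↗x) (n<1+n _)))
  ascend v x (y ∷ ys) (x~y ∷ walk) x<v with v Fin.≟ y
  ... | yes refl = inj₁ (here refl)
  ... | no v≢y = [ inj₁ ∘ there , inj₂ ]′ (ascend v y ys walk (y<v x~y))
    where
    y<v : Step x y → toℕ y < toℕ v
    y<v (inj₂ y↗x) = <-trans (subst (toℕ y <_) (sym y↗x) (n<1+n _)) x<v
    y<v (inj₁ x↗y) with m≤n⇒m<n∨m≡n (subst (_≤ toℕ v) (sym x↗y) x<v)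
    ... | inj₁ y<v = y<v
    ... | inj₂ y≡v = ⊥-elim (v≢y (toℕ-injective (sym y≡v)))

  -- the first step away from v and the last step back into v would visit the same vertex
  Step-acyclic : ∀ v a b rest → Unique (v ∷ a ∷ b ∷ rest) → ¬ Linked Step ((v ∷ a ∷ b ∷ rest) ∷ʳ v)
  Step-acyclic v a b rest (v∉ ∷ a∉ ∷ _) (inj₁ v↗a ∷ walk)
    with descend v a (b ∷ rest) walk (subst (toℕ v <_) (sym v↗a) (n<1+n _))
  ... | inj₁ v∈       = All.lookup v∉ (there v∈) refl
  ... | inj₂ v↗last   = All.lookup a∉ (last∈ a b rest) (toℕ-injective (trans v↗a (sym v↗last)))
  Step-acyclic v a b rest (v∉ ∷ a∉ ∷ _) (inj₂ a↗v ∷ walk)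
    with ascend v a (b ∷ rest) walk (subst (toℕ a <_) (sym a↗v) (n<1+n _))
  ... | inj₁ v∈       = All.lookup v∉ (there v∈) refl
  ... | inj₂ last↗v   = All.lookup a∉ (last∈ a b rest) (toℕ-injective (suc-injective (trans (sym a↗v) last↗v)))

Up-irrefl : ∀ {n} {i : Fin n} → ¬ Up i i
Up-irrefl i↗i = 1+n≢n (sym i↗i)

Step-connected : ∀ {m} (i : Fin (suc m)) → Star Step zero i
Step-connected zero             = ε
Step-connected {suc m} (suc i) = inj₁ refl ◅ Star.gmap suc (Sum.map (cong suc) (cong suc)) (Step-connected i)

PathArc : {m : ℕ} → (Fin (suc m) → Bool) → Rel (Fin (suc m)) 0ℓ
PathArc side i j = Step i j × side i ≡ false × side j ≡ true

path : (m : ℕ) → (Fin (suc m) → Bool) → Digraph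
path m side = record
  { size = suc m
  ; arc  = λ i j → ⌊ step? i j ×-dec (side i Bool.≟ false) ×-dec (side j Bool.≟ true) ⌋
  }

module _ {m : ℕ} (side : Fin (suc m) → Bool) where

  path-arc : ∀ {i j} → T (arc (path m side) i j) → PathArc side i j
  path-arc = toWitness

  path-height : HeightAtMostOne (path m side) side
  path-height _ _ = proj₂ ∘ path-arc

  Alternating : Set
  Alternating = ∀ i j → Up i j → side j ≡ not (side i)

  Adj⇒Step : ∀ {i j} → Adj (path m side) i j → Step i j
  Adj⇒Step (inj₁ ij) = proj₁ (path-arc ij)
  Adj⇒Step (inj₂ ji) = swap (proj₁ (path-arc ji))

  path-acyclic : ∀ cs → ¬ IsCycle (path m side) cs
  path-acyclic (_ ∷ [])     (s≤s () , _)
  path-acyclic (_ ∷ _ ∷ []) (s≤s (s≤s ()) , _)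
  path-acyclic (v ∷ a ∷ b ∷ rest) (_ , unique , cycle) =
    Step-acyclic v a b rest unique (Linked.map Adj⇒Step cycle)

  module _ (alternating : Alternating) where

    Up⇒Adj : ∀ {i j} → Up i j → Adj (path m side) i j
    Up⇒Adj {i} {j} i↗j = orient (side i) refl (alternating i j i↗j)
      where
      orient : ∀ b → side i ≡ b → side j ≡ not (side i) → Adj (path m side) i j
      orient false side-i side-j = inj₁ (fromWitness (inj₁ i↗j , side-i , trans side-j (cong not side-i)))
      orient true  side-i side-j = inj₂ (fromWitness (inj₂ i↗j , trans side-j (cong not side-i) , side-i))

    Step⇒Adj : ∀ {i j} → Step i j → Adj (path m side) i j
    Step⇒Adj (inj₁ i↗j) = Up⇒Adj i↗j
    Step⇒Adj (inj₂ j↗i) = swap (Up⇒Adj j↗i)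

    distinct : ∀ {b} → b ≡ true → b ≡ false → ⊥
    distinct refl ()

    path-isOrientedTree : IsOrientedTree (path m side)
    path-isOrientedTree = record
      { nonempty  = s≤s z≤n
      ; loopless  = λ i ii → [ Up-irrefl , Up-irrefl ]′ (proj₁ (path-arc ii))
      ; no-digon  = λ i j ij ji → distinct (proj₂ (proj₂ (path-arc ij))) (proj₁ (proj₂ (path-arc ji)))
      ; connected = λ i j → Star.map Step⇒Adj (Star.reverse swap (Step-connected i) ◅◅ Step-connected j)
      ; acyclic   = path-acyclic
      }

-- Walks

module _ {A : Set} {R : A → A → Set} where

  later : ∀ {x y} → Star R x y → List A
  later ε                  = []
  later (_◅_ {j = y} _ s) = y ∷ later s

  vertices : ∀ {x y} → Star R x y → List A
  vertices {x} s = x ∷ later s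

  vertices-linked : ∀ {x y} (s : Star R x y) → Linked R (vertices s)
  vertices-linked ε             = [-]
  vertices-linked (r ◅ ε)       = r ∷ [-]
  vertices-linked (r ◅ r′ ◅ s)  = r ∷ vertices-linked (r′ ◅ s)

  end∈vertices : ∀ {x y} (s : Star R x y) → y ∈ vertices s
  end∈vertices ε       = here refl
  end∈vertices (_ ◅ s) = there (end∈vertices s)

  ∈-vertices-◅◅ˡ : ∀ {x y z v} (s : Star R x y) (s′ : Star R y z) →
                   v ∈ vertices s → v ∈ vertices (s ◅◅ s′)
  ∈-vertices-◅◅ˡ ε       _  (here refl) = here refl
  ∈-vertices-◅◅ˡ (_ ◅ s) s′ (here refl) = here refl
  ∈-vertices-◅◅ˡ (_ ◅ s) s′ (there v∈) = there (∈-vertices-◅◅ˡ s s′ v∈)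

  ∈-vertices-◅◅ʳ : ∀ {x y z v} (s : Star R x y) (s′ : Star R y z) →
                   v ∈ vertices s′ → v ∈ vertices (s ◅◅ s′)
  ∈-vertices-◅◅ʳ ε       _  v∈ = v∈
  ∈-vertices-◅◅ʳ (_ ◅ s) s′ v∈ = there (∈-vertices-◅◅ʳ s s′ v∈)

  module _ (R-sym : Symmetric R) {c : A} where

    tour : (ps : List A) → All (Star R c) ps → Star R c c
    tour []       []         = ε
    tour (_ ∷ ps) (s ∷ rest) = s ◅◅ Star.reverse R-sym s ◅◅ tour ps rest

    tour-visits : ∀ {p} ps (paths : All (Star R c) ps) → p ∈ ps → p ∈ vertices (tour ps paths)
    tour-visits (_ ∷ _)  (s ∷ _)    (here refl) = ∈-vertices-◅◅ˡ s _ (end∈vertices s)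
    tour-visits (_ ∷ ps) (s ∷ rest) (there p∈)  =
      ∈-vertices-◅◅ʳ s _ (∈-vertices-◅◅ʳ (Star.reverse R-sym s) _ (tour-visits ps rest p∈))

Linked-lookup : ∀ {A : Set} {R : A → A → Set} {xs : List A} → Linked R xs →
                ∀ i j → Up i j → R (lookup xs i) (lookup xs j)
Linked-lookup (r ∷ _)    zero    (suc zero) _  = r
Linked-lookup (_ ∷ rest) (suc i) (suc j)    eq = Linked-lookup rest i j (suc-injective eq)

-- Sproinks and arc graphs

⟶-refl : ∀ {G} → G ⟶ G
⟶-refl = (λ x → x) , λ _ _ xy → xy

⟶-trans : ∀ {F G H} → F ⟶ G → G ⟶ H → F ⟶ H
⟶-trans (f , f-hom) (g , g-hom) = g ∘ f , λ x y → g-hom _ _ ∘ f-hom x y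

open IsOrientedTree using (nonempty; connected)

arcList-arc : ∀ H i → T (uncurry (arc H) (lookup (arcList H) i))
arcList-arc H i =
  proj₂ (∈-filter⁻ (T? ∘ uncurry (arc H)) {xs = cartesianProduct (allFin (size H)) (allFin (size H))} (∈-lookup i))

arc⇒∈arcList : ∀ H {a b} → T (arc H a b) → (a , b) ∈ arcList H
arc⇒∈arcList H {a} {b} = ∈-filter⁺ (T? ∘ uncurry (arc H)) (∈-cartesianProduct⁺ (∈-allFin a) (∈-allFin b))

δ-arc : ∀ H {i j} → T (arc (δ H) i j) → proj₂ (lookup (arcList H) i) ≡ proj₁ (lookup (arcList H) j)
δ-arc H = toWitness

sproink⟶δ⇒⟶ : ∀ {Tr S H} → IsSproink Tr S → S ⟶ δ H → Tr ⟶ H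
sproink⟶δ⇒⟶ {Tr} {S} {H} (d , π , _ , π-≡⇔ , π-arc⇔) (h , h-hom) = vertex , vertex-hom
  where
  open SproinkData d
  open SproinkOf d
  open ≡-Reasoning

  arcOf : Pt → Fin (size H) × Fin (size H)
  arcOf p = lookup (arcList H) (h (π p))

  end : Bool → Fin (size H) × Fin (size H) → Fin (size H)
  end true  = proj₁
  end false = proj₂

  -- x ∈ 0 is read at the head of its arc and y ∈ 1 at the tail, so for an arc x → y of F(u),
  -- which goes to two consecutive arcs of H, both give the vertex where these arcs meet
  endpoint : Pt → Fin (size H)
  endpoint (u , x) = end (side u x) (arcOf (u , x))

  endpoint-arc : ∀ u {x y} → T (arc (F u) x y) → endpoint (u , x) ≡ endpoint (u , y)
  endpoint-arc u {x} {y} xy with F-height u x y xy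
  ... | x∈0 , y∈1 rewrite x∈0 | y∈1 =
    δ-arc H (h-hom _ _ (Equivalence.from (π-arc⇔ _ _) (_ , _ , refl , refl , uarc u x y xy)))

  endpoint-adj : ∀ u {x y} → Adj (F u) x y → endpoint (u , x) ≡ endpoint (u , y)
  endpoint-adj u (inj₁ xy) = endpoint-arc u xy
  endpoint-adj u (inj₂ yx) = sym (endpoint-arc u yx)

  vertex : Fin (size Tr) → Fin (size H)
  vertex u = endpoint (u , fromℕ< (nonempty (F-tree u)))

  endpoint≡vertex : ∀ u x → endpoint (u , x) ≡ vertex u
  endpoint≡vertex u x = Star.fold _ (λ xy eq → trans (endpoint-adj u xy) eq) refl (connected (F-tree u) x _)

  vertex-hom : ∀ u u′ → T (arc Tr u u′) → T (arc H (vertex u) (vertex u′))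
  vertex-hom u u′ e = subst₂ (λ a b → T (arc H a b)) tail≡ head≡ (arcList-arc H (h (π out)))
    where
    out inc : Pt
    out = u , vOut u u′ e
    inc = u′ , vIn u u′ e

    glued : π out ≡ π inc
    glued = Equivalence.from (π-≡⇔ out inc) (fwd (glue u u′ e) ◅ ε)

    tail≡ : proj₁ (arcOf out) ≡ vertex u
    tail≡ = begin
      proj₁ (arcOf out) ≡⟨ cong (λ b → end b (arcOf out)) (sym (vOut-1 u u′ e)) ⟩
      endpoint out      ≡⟨ endpoint≡vertex u _ ⟩
      vertex u          ∎

    head≡ : proj₂ (arcOf out) ≡ vertex u′
    head≡ = begin
      proj₂ (arcOf out) ≡⟨ cong (proj₂ ∘ lookup (arcList H) ∘ h) glued ⟩
      proj₂ (arcOf inc) ≡⟨ cong (λ b → end b (arcOf inc)) (sym (vIn-0 u u′ e)) ⟩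
      endpoint inc      ≡⟨ endpoint≡vertex u′ _ ⟩
      vertex u′         ∎

module SproinkRealisation {Tr : Digraph} (d : SproinkData Tr) where
  open SproinkData d
  open SproinkOf d

  Pt-enumeration : Enumeration Pt
  Pt-enumeration = Σ-enumeration (Fin-enumeration _) (λ u → Fin-enumeration _)

  glue? : Decidable Glue
  glue? (u , x) (u′ , y) with T? (arc Tr u u′)
  ... | no ¬e = no λ { (glue _ _ e) → ¬e e }
  ... | yes e with x Fin.≟ vOut u u′ e | y Fin.≟ vIn u u′ e
  ...   | yes refl | yes refl = yes (glue u u′ e)
  ...   | no x≢    | _        = no λ { (glue _ _ e′) → x≢ (cong (vOut u u′) (T-irrelevant e′ e)) }
  ...   | _        | no y≢    = no λ { (glue _ _ e′) → y≢ (cong (vIn u u′) (T-irrelevant e′ e)) }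

  uarc? : Decidable UArc
  uarc? (u , x) (u′ , y) with u Fin.≟ u′
  ... | yes refl = map′ (uarc u x y) (λ { (uarc _ _ _ xy) → xy }) (T? (arc (F u) x y))
  ... | no u≢    = no λ { (uarc _ _ _ _) → u≢ refl }

  open QuotientDigraph (closureQuotient (≡-dec Fin._≟_ Fin._≟_) Pt-enumeration glue?)
                       Pt-enumeration uarc? public

  isSproink : IsSproink Tr digraph
  isSproink = d , class , class-surjective , class-≡⇔ , arc⇔

  sproink⟶ : ∀ G (φ : Pt → Fin (size G)) → (∀ {p q} → Glue p q → φ p ≡ φ q) →
             (∀ {p q} → UArc p q → T (arc G (φ p) (φ q))) → digraph ⟶ G
  sproink⟶ G φ φ-glue = lift G φ (EqClosure.fold (On.isEquivalence φ isEquivalence) φ-glue)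

module ArcGraphLeftAdjoint (G : Digraph) where

  -- (x , true) and (x , false) are the tail and the head of the arc standing for the vertex x of G;
  -- the Boolean is also the side (1 or 0) of the point in the sproink built below
  Point : Set
  Point = Fin (size G) × Bool

  pattern tailOf x = x , true
  pattern headOf x = x , false

  data Joined : Point → Point → Set where
    joined : ∀ {x y} → T (arc G x y) → Joined (headOf x) (tailOf y)

  data Ends : Point → Point → Set where
    ends : ∀ x → Ends (tailOf x) (headOf x)

  joined? : Decidable Joined
  joined? (headOf x) (tailOf y) = map′ joined (λ { (joined xy) → xy }) (T? (arc G x y))
  joined? (tailOf _) _          = no λ ()
  joined? (headOf _) (headOf _) = no λ ()

  ends? : Decidable Ends
  ends? (tailOf x) (headOf y) = map′ (λ { refl → ends x }) (λ { (ends _) → refl }) (x Fin.≟ y)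
  ends? (headOf _) _          = no λ ()
  ends? (tailOf _) (tailOf _) = no λ ()

  Point-enumeration : Enumeration Point
  Point-enumeration = Σ-enumeration (Fin-enumeration _) (λ _ → Bool-enumeration)

  open QuotientDigraph (closureQuotient (≡-dec Fin._≟_ Bool._≟_) Point-enumeration joined?)
                       Point-enumeration ends? public

  ⟶δ : ∀ {H} → digraph ⟶ H → G ⟶ δ H
  ⟶δ {H} (g , g-hom) = f , f-hom
    where
    open ≡-Reasoning

    arcOf∈ : ∀ x → (g (class (tailOf x)) , g (class (headOf x))) ∈ arcList H
    arcOf∈ x = arc⇒∈arcList H (g-hom _ _ (Equivalence.from (arc⇔ _ _) (_ , _ , refl , refl , ends x)))

    f : Fin (size G) → Fin (size (δ H))
    f x = index (arcOf∈ x)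

    lookup-f : ∀ x → lookup (arcList H) (f x) ≡ (g (class (tailOf x)) , g (class (headOf x)))
    lookup-f x = sym (lookup-index (arcOf∈ x))

    f-hom : ∀ x y → T (arc G x y) → T (arc (δ H) (f x) (f y))
    f-hom x y xy = fromWitness (begin
      proj₂ (lookup (arcList H) (f x)) ≡⟨ cong proj₂ (lookup-f x) ⟩
      g (class (headOf x))             ≡⟨ cong g (Equivalence.from (class-≡⇔ _ _) (fwd (joined xy) ◅ ε)) ⟩
      g (class (tailOf y))             ≡⟨ cong proj₁ (sym (lookup-f y)) ⟩
      proj₁ (lookup (arcList H) (f y)) ∎)

  Carrier : Fin card → Fin card → Set
  Carrier i j = Σ (Fin (size G)) λ x → class (tailOf x) ≡ i × class (headOf x) ≡ j

  carrier : ∀ i j → T (arc digraph i j) → Carrier i j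
  carrier i j = fromImage ∘ Equivalence.to (arc⇔ i j)
    where
    fromImage : ImageArc i j → Carrier i j
    fromImage (_ , _ , tail≡ , head≡ , ends x) = x , tail≡ , head≡

  Joined-flips : ∀ {p q} → SymClosure Joined p q → proj₂ q ≡ not (proj₂ p)
  Joined-flips (fwd (joined _)) = refl
  Joined-flips (bwd (joined _)) = refl

  Joined-arc : ∀ {p q} → SymClosure Joined p q → proj₂ p ≡ false → T (arc G (proj₁ p) (proj₁ q))
  Joined-arc (fwd (joined xy)) _ = xy
  Joined-arc (bwd (joined _)) ()

  -- F(u) is the zigzag path read off a closed walk of identifications through the whole class t(u);
  -- the arc u → u′ of Tr is carried by a vertex x of G with tail in t(u) and head in t(u′)
  sproink : ∀ {Tr} → Tr ⟶ digraph → Σ Digraph λ S → IsSproink Tr S × (S ⟶ G)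
  sproink {Tr} (t , t-hom) = Sproink.digraph , Sproink.isSproink , Sproink.sproink⟶ G φ φ-glue φ-arc
    where
    in-class? : ∀ u p → Dec (class p ≡ t u)
    in-class? u p = class p Fin.≟ t u

    members : Fin (size Tr) → List Point
    members u = filter (in-class? u) (proj₁ Point-enumeration)

    centre : Fin (size Tr) → Point
    centre u = proj₁ (class-surjective (t u))

    reach : ∀ u → All (EqClosure Joined (centre u)) (members u)
    reach u = All.tabulate λ p∈ → Equivalence.to (class-≡⇔ _ _)
      (trans (proj₂ (class-surjective (t u)))
             (sym (proj₂ (∈-filter⁻ (in-class? u) {xs = proj₁ Point-enumeration} p∈))))

    walk : ∀ u → EqClosure Joined (centre u) (centre u)
    walk u = tour (SymClosure.symmetric Joined) (members u) (reach u)

    visits : ∀ u {p} → class p ≡ t u → p ∈ vertices (walk u)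
    visits u {p} p∈ =
      tour-visits _ (members u) (reach u) (∈-filter⁺ (in-class? u) (proj₂ Point-enumeration p) p∈)

    point : ∀ u → Fin (suc (length (later (walk u)))) → Point
    point u = lookup (vertices (walk u))

    alternating : ∀ u → Alternating (proj₂ ∘ point u)
    alternating u i j i↗j = Joined-flips (Linked-lookup (vertices-linked (walk u)) i j i↗j)

    carried : ∀ {u u′} → T (arc Tr u u′) → Carrier (t u) (t u′)
    carried {u} {u′} e = carrier (t u) (t u′) (t-hom u u′ e)

    x[_] : ∀ {u u′} → T (arc Tr u u′) → Fin (size G)
    x[ e ] = proj₁ (carried e)

    out∈ : ∀ {u u′} (e : T (arc Tr u u′)) → tailOf x[ e ] ∈ vertices (walk u)
    out∈ e = visits _ (proj₁ (proj₂ (carried e)))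

    in∈ : ∀ {u u′} (e : T (arc Tr u u′)) → headOf x[ e ] ∈ vertices (walk u′)
    in∈ e = visits _ (proj₂ (proj₂ (carried e)))

    d : SproinkData Tr
    d = record
      { F        = λ u → path _ (proj₂ ∘ point u)
      ; F-tree   = λ u → path-isOrientedTree _ (alternating u)
      ; side     = λ u → proj₂ ∘ point u
      ; F-height = λ u → path-height _
      ; vOut     = λ u u′ e → index (out∈ e)
      ; vOut-1   = λ u u′ e → cong proj₂ (sym (lookup-index (out∈ e)))
      ; vIn      = λ u u′ e → index (in∈ e)
      ; vIn-0    = λ u u′ e → cong proj₂ (sym (lookup-index (in∈ e)))
      }

    open SproinkOf d
    module Sproink = SproinkRealisation d

    φ : Pt → Fin (size G)
    φ (u , i) = proj₁ (point u i)

    φ-glue : ∀ {p q} → Glue p q → φ p ≡ φ q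
    φ-glue (glue u u′ e) =
      trans (cong proj₁ (sym (lookup-index (out∈ e)))) (cong proj₁ (lookup-index (in∈ e)))

    consecutive : ∀ u {i j} → Step i j → SymClosure Joined (point u i) (point u j)
    consecutive u {i} {j} (inj₁ i↗j) = Linked-lookup (vertices-linked (walk u)) i j i↗j
    consecutive u {i} {j} (inj₂ j↗i) =
      SymClosure.symmetric Joined (Linked-lookup (vertices-linked (walk u)) j i j↗i)

    φ-arc : ∀ {p q} → UArc p q → T (arc G (φ p) (φ q))
    φ-arc (uarc u i j ij) = let i~j , side-i , _ = path-arc _ ij in Joined-arc (consecutive u i~j) side-i

theorem3 : (H : Digraph) (𝓕 : Digraph → Set)
    → (∀ Tr → 𝓕 Tr → IsOrientedTree Tr)
    → CompleteObstructions 𝓕 H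
    → CompleteObstructions (Sproinks 𝓕) (δ H)
theorem3 H 𝓕 _ obstructs G = mk⇔ sound complete
  where
  open ArcGraphLeftAdjoint G using (⟶δ; sproink) renaming (digraph to δᴸG)

  sound : G ⟶ δ H → ¬ Σ Digraph (λ S → Sproinks 𝓕 S × (S ⟶ G))
  sound G⟶δH (S , (Tr , Tr∈𝓕 , S-sproink) , S⟶G) =
    Equivalence.to (obstructs Tr)
      (sproink⟶δ⇒⟶ {H = H} S-sproink (⟶-trans {H = δ H} S⟶G G⟶δH))
      (Tr , Tr∈𝓕 , ⟶-refl)

  complete : ¬ Σ Digraph (λ S → Sproinks 𝓕 S × (S ⟶ G)) → G ⟶ δ H
  complete no-sproink = ⟶δ (Equivalence.from (obstructs δᴸG) λ (Tr , Tr∈𝓕 , Tr⟶δᴸG) →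
    let S , S-sproink , S⟶G = sproink Tr⟶δᴸG in no-sproink (S , (Tr , Tr∈𝓕 , S-sproink) , S⟶G))
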